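{- Let $\alpha(k)$ be the largest odd divisor of $k$ and $G(n)=\sum_{k=1}^n\frac{n+1-k}{k}\alpha(k)$. For every positive integer $n$, $$0\le\frac{n(n+2)}{3}-G(n)\le\theta_n\le\frac19\lfloor\log_2 n\rfloor+\frac1{18},$$ where $\theta_n=\frac19\left(\lfloor\log_2 n\rfloor+\mathrm{round}(2^{\lfloor\log_2 n\rfloor}/3)\,2^{ -\lfloor\log_2 n\rfloor}\right)$ and $\mathrm{round}(\cdot)$ denotes the nearest integer.
   Context: $\alpha(k)$ is the largest odd divisor of the positive integer $k$; $\lfloor\cdot\rfloor$ is the floor function. -}

module Defs where

open import Data.Nat as ℕ using (ℕ; zero; suc; _%_; _^_; _∸_)
open import Data.Nat.Divisibility using (_∣?_)
open import Data.Nat.Logarithm using (⌊log₂_⌋)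
open import Data.Nat.Properties using (_≟_)
open import Data.Integer as ℤ using (ℤ; +_)
open import Data.Rational using (ℚ; _/_; _+_; _*_; 0ℚ; round)
open import Data.List using (List; foldr; filter; map; upTo)
open import Relation.Nullary.Decidable using (_×-dec_)

ℕtoℚ : ℕ → ℚ
ℕtoℚ n = (+ n) / 1

ℤtoℚ : ℤ → ℚ
ℤtoℚ z = z / 1

α : ℕ → ℕ
α k = foldr ℕ._⊔_ 0 (filter (λ d → (d % 2 ≟ 1) ×-dec (d ∣? k)) (upTo (suc k)))

sumℚ : List ℚ → ℚ
sumℚ = foldr _+_ 0ℚ

-- G n = Σ_{k=1}^{n} (n+1-k)/k · α(k); here k = suc i for i ∈ {0,…,n-1}
G : ℕ → ℚ
G n = sumℚ (map (λ i → ((+ (suc n ∸ suc i)) / suc i) * ℕtoℚ (α (suc i))) (upTo n))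

θ : ℕ → ℚ
θ n = ((+ 1) / 9) * (ℕtoℚ m + ℤtoℚ (round ((+ (2 ^ m)) / 3)) * (1/2^ m))
  where
  m = ⌊log₂ n ⌋
  1/2^ : ℕ → ℚ
  1/2^ zero = ℕtoℚ 1
  1/2^ (suc j) = ((+ 1) / 2) * 1/2^ j

{-# OPTIONS --safe #-}
-- With S n = Σ_{k=1}^{n} α(k)/k one has G (n+1) = G n + S (n+1), and α(2k) = α(k),
-- α(2k+1) = 2k+1.  Hence the defect D n = n(n+2)/3 - G n and E n = S n - 2n/3 obey
--   D (2p+1) = D p,   D (2p) = D p + E p / 2,   E (2p) = E p / 2,   E (2p+1) = E p / 2 + 1/3.
-- Induction along n ↦ 2n, 2n+1 preserves
--   0 ≤ E n,  0 ≤ D n ≤ ϑ m,  D n + E n / 2 ≤ ϑ (m+1),  D n + E n ≤ ϑ m + 1/3   (m = ⌊log₂ n⌋)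
-- for ϑ 0 = 0, ϑ 1 = 1/6, ϑ (m+2) = (ϑ (m+1) + ϑ m)/2 + 1/6.  Solving the recurrence gives
-- ϑ m = (m + J m / 2^m)/9 with J the Jacobsthal numbers, and 3 J m = 2^m - (-1)^m shows
-- J m = round (2^m/3), i.e. ϑ ⌊log₂ n⌋ = θ n; and ϑ m ≤ m/9 + 1/18.
module Submission where

open import Data.Bool using (true; false; T; if_then_else_)
open import Data.Integer.Base as ℤ using (ℤ; +_)
import Data.Integer.DivMod as ℤ
import Data.Integer.Properties as ℤ
open import Data.Integer.Tactic.RingSolver as ℤ-Ring using ()
open import Data.List using (List; []; _∷_; _∷ʳ_; filter; foldr; upTo; applyUpTo)
open import Data.List.Membership.Propositional using (_∈_)
open import Data.List.Membership.Propositional.Properties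
  using (∈-filter⁺; ∈-filter⁻; ∈-upTo⁺; ∈-upTo⁻)
open import Data.List.Properties using (foldr-preservesᵇ; foldr-preservesᵒ; applyUpTo-∷ʳ; map-upTo)
open import Data.List.Relation.Binary.Subset.Propositional using (_⊆_)
import Data.List.Relation.Unary.All as All
import Data.List.Relation.Unary.Any as Any
open import Data.Nat using (ℕ; _≥_)
open import Data.Nat.Base as ℕ using (zero; suc; _%_; _^_; ⌊_/2⌋; z≤n; s≤s)
open import Data.Nat.Coprimality using (Coprime; coprime-divisor)
open import Data.Nat.Divisibility
  using (_∣_; _∣?_; ∣-refl; ∣-trans; ∣⇒≤; n∣m*n; 0∣⇒≡0; n∣m⇒m%n≡0)
open import Data.Nat.DivMod using ([m+kn]%n≡m%n)
open import Data.Nat.Induction using (<-rec)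
open import Data.Nat.Logarithm
  using (⌊log₂_⌋; ⌊log₂⌋-mono-≤; ⌊log₂⌊n/2⌋⌋≡⌊log₂n⌋∸1; ⌊log₂[2*b]⌋≡1+⌊log₂b⌋)
import Data.Nat.Properties as ℕ
open import Data.Nat.Tactic.RingSolver as ℕ-Ring using ()
open import Data.Product using (_×_; _,_; proj₁; proj₂)
open import Data.Rational.Base hiding (_≥_)
open import Data.Rational.Properties
import Data.Rational.Unnormalised.Base as ℚᵘ
import Data.Rational.Unnormalised.Properties as ℚᵘ
open import Data.Sum using (_⊎_; inj₁; inj₂)
open import Data.Unit using (tt)
open import Function using (_∘_)
open import Relation.Binary.PropositionalEquality
open import Relation.Nullary.Decidable using (_×-dec_; dec⇒maybe; toWitness)
open import Relation.Nullary.Negation using (contradiction)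
open import Tactic.RingSolver using (solve-∀)
open import Tactic.RingSolver.Core.AlmostCommutativeRing
  using (AlmostCommutativeRing; fromCommutativeRing)

open import Defs

-- Largest odd divisor

Odd : ℕ → Set
Odd d = d % 2 ≡ 1

oddDivisors : ℕ → List ℕ
oddDivisors k = filter (λ d → (d % 2 ℕ.≟ 1) ×-dec (d ∣? k)) (upTo (suc k))

maximum : List ℕ → ℕ
maximum = foldr ℕ._⊔_ 0

∈⇒≤maximum : ∀ {x xs} → x ∈ xs → x ℕ.≤ maximum xs
∈⇒≤maximum {x} {xs} x∈xs =
  foldr-preservesᵒ {P = x ℕ.≤_} ≤-⊔ 0 xs (inj₂ (Any.map ℕ.≤-reflexive x∈xs))
  where
  ≤-⊔ : ∀ a b → x ℕ.≤ a ⊎ x ℕ.≤ b → x ℕ.≤ a ℕ.⊔ b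
  ≤-⊔ a b (inj₁ x≤a) = ℕ.m≤n⇒m≤n⊔o b x≤a
  ≤-⊔ a b (inj₂ x≤b) = ℕ.m≤n⇒m≤o⊔n a x≤b

maximum-least : ∀ {b xs} → (∀ {x} → x ∈ xs → x ℕ.≤ b) → maximum xs ℕ.≤ b
maximum-least bound = foldr-preservesᵇ ℕ.⊔-lub z≤n (All.tabulate bound)

maximum-mono-⊆ : ∀ {xs ys} → xs ⊆ ys → maximum xs ℕ.≤ maximum ys
maximum-mono-⊆ xs⊆ys = maximum-least (λ x∈xs → ∈⇒≤maximum (xs⊆ys x∈xs))

∈-oddDivisors⁺ : ∀ {d k} → d ℕ.≤ k → Odd d → d ∣ k → d ∈ oddDivisors k
∈-oddDivisors⁺ d≤k odd d∣k =
  ∈-filter⁺ (λ d → (d % 2 ℕ.≟ 1) ×-dec (d ∣? _)) (∈-upTo⁺ (s≤s d≤k)) (odd , d∣k)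

∈-oddDivisors⁻ : ∀ {d} k → d ∈ oddDivisors k → d ℕ.≤ k × Odd d × d ∣ k
∈-oddDivisors⁻ k d∈ with d∈upTo , odd , d∣k ← ∈-filter⁻ (λ d → (d % 2 ℕ.≟ 1) ×-dec (d ∣? k)) d∈ =
  ℕ.s≤s⁻¹ (∈-upTo⁻ d∈upTo) , odd , d∣k

odd⇒coprime-2 : ∀ {d} → Odd d → Coprime d 2
odd⇒coprime-2 odd {zero} (_ , 0∣2) with () ← 0∣⇒≡0 0∣2
odd⇒coprime-2 odd {1} _ = refl
odd⇒coprime-2 {d} odd {2} (2∣d , _) with () ← trans (sym odd) (n∣m⇒m%n≡0 d 2 2∣d)
odd⇒coprime-2 odd {suc (suc (suc i))} (_ , i∣2) with s≤s (s≤s ()) ← ∣⇒≤ i∣2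

α-odd : ∀ p → α (suc (2 ℕ.* p)) ≡ suc (2 ℕ.* p)
α-odd p = ℕ.≤-antisym
  (maximum-least (λ d∈ → proj₁ (∈-oddDivisors⁻ _ d∈)))
  (∈⇒≤maximum (∈-oddDivisors⁺ ℕ.≤-refl odd ∣-refl))
  where
  odd : Odd (suc (2 ℕ.* p))
  odd = trans (cong (λ m → suc m % 2) (ℕ.*-comm 2 p)) ([m+kn]%n≡m%n 1 p 2)

α-double : ∀ k → α (2 ℕ.* k) ≡ α k
α-double zero      = refl
α-double k@(suc _) = ℕ.≤-antisym (maximum-mono-⊆ halve) (maximum-mono-⊆ double)
  where
  halve : oddDivisors (2 ℕ.* k) ⊆ oddDivisors k
  halve d∈ with _ , odd , d∣2k ← ∈-oddDivisors⁻ (2 ℕ.* k) d∈ =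
    let d∣k = coprime-divisor (odd⇒coprime-2 odd) d∣2k in ∈-oddDivisors⁺ (∣⇒≤ d∣k) odd d∣k
  double : oddDivisors k ⊆ oddDivisors (2 ℕ.* k)
  double d∈ with d≤k , odd , d∣k ← ∈-oddDivisors⁻ k d∈ =
    ∈-oddDivisors⁺ (ℕ.≤-trans d≤k (ℕ.m≤m+n k _)) odd (∣-trans d∣k (n∣m*n 2))

-- Natural numbers and finite sums in ℚ

ℚ-ring : AlmostCommutativeRing _ _
ℚ-ring = fromCommutativeRing +-*-commutativeRing (λ x → dec⇒maybe (0ℚ ≟ x))

toℚᵘ-/ : ∀ i d → toℚᵘ (i / suc d) ℚᵘ.≃ ℚᵘ.mkℚᵘ i d
toℚᵘ-/ i d = toℚᵘ-fromℚᵘ (ℚᵘ.mkℚᵘ i d)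

toℚᵘ-+ : ∀ p r {u v} → toℚᵘ p ℚᵘ.≃ u → toℚᵘ r ℚᵘ.≃ v → toℚᵘ (p + r) ℚᵘ.≃ u ℚᵘ.+ v
toℚᵘ-+ p r p≃u r≃v = ℚᵘ.≃-trans (toℚᵘ-homo-+ p r) (ℚᵘ.+-cong p≃u r≃v)

toℚᵘ-* : ∀ p r {u v} → toℚᵘ p ℚᵘ.≃ u → toℚᵘ r ℚᵘ.≃ v → toℚᵘ (p * r) ℚᵘ.≃ u ℚᵘ.* v
toℚᵘ-* p r p≃u r≃v = ℚᵘ.≃-trans (toℚᵘ-homo-* p r) (ℚᵘ.*-cong p≃u r≃v)

≡-via-ℚᵘ : ∀ {p r u v} → toℚᵘ p ℚᵘ.≃ u → toℚᵘ r ℚᵘ.≃ v → u ℚᵘ.≃ v → p ≡ r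
≡-via-ℚᵘ p≃u r≃v u≃v = toℚᵘ-injective (ℚᵘ.≃-trans p≃u (ℚᵘ.≃-trans u≃v (ℚᵘ.≃-sym r≃v)))

ℕtoℚ-+ : ∀ m n → ℕtoℚ (m ℕ.+ n) ≡ ℕtoℚ m + ℕtoℚ n
ℕtoℚ-+ m n = ≡-via-ℚᵘ (toℚᵘ-/ (+ (m ℕ.+ n)) 0)
  (toℚᵘ-+ (ℕtoℚ m) (ℕtoℚ n) (toℚᵘ-/ (+ m) 0) (toℚᵘ-/ (+ n) 0))
  (ℚᵘ.*≡* (identity (+ m) (+ n)))
  where
  identity : ∀ x y → (x ℤ.+ y) ℤ.* + 1 ≡ (x ℤ.* + 1 ℤ.+ y ℤ.* + 1) ℤ.* + 1
  identity = ℤ-Ring.solve-∀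

ℕtoℚ-* : ∀ m n → ℕtoℚ (m ℕ.* n) ≡ ℕtoℚ m * ℕtoℚ n
ℕtoℚ-* m n = ≡-via-ℚᵘ (toℚᵘ-/ (+ (m ℕ.* n)) 0)
  (toℚᵘ-* (ℕtoℚ m) (ℕtoℚ n) (toℚᵘ-/ (+ m) 0) (toℚᵘ-/ (+ n) 0))
  (ℚᵘ.*≡* (cong (ℤ._* + 1) (ℤ.pos-* m n)))

ℕtoℚ-suc : ∀ n → ℕtoℚ (suc n) ≡ 1ℚ + ℕtoℚ n
ℕtoℚ-suc = ℕtoℚ-+ 1

ℕtoℚ-double : ∀ n → ℕtoℚ (2 ℕ.* n) ≡ ℕtoℚ n + ℕtoℚ n
ℕtoℚ-double n = trans (ℕtoℚ-+ n (n ℕ.+ 0)) (cong (λ m → ℕtoℚ n + ℕtoℚ m) (ℕ.+-identityʳ n))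

ℕtoℚ-suc-double : ∀ n → ℕtoℚ (suc (2 ℕ.* n)) ≡ 1ℚ + (ℕtoℚ n + ℕtoℚ n)
ℕtoℚ-suc-double n = trans (ℕtoℚ-suc (2 ℕ.* n)) (cong (λ x → 1ℚ + x) (ℕtoℚ-double n))

k/d≡k*[1/d] : ∀ k d → (+ k) / suc d ≡ ℕtoℚ k * ((+ 1) / suc d)
k/d≡k*[1/d] k d = ≡-via-ℚᵘ (toℚᵘ-/ (+ k) d)
  (toℚᵘ-* (ℕtoℚ k) _ (toℚᵘ-/ (+ k) 0) (toℚᵘ-/ (+ 1) d))
  (ℚᵘ.*≡* (trans (cong (λ e → + k ℤ.* + suc e) (ℕ.+-identityʳ d)) (identity (+ k) (+ suc d))))
  where
  identity : ∀ x y → x ℤ.* y ≡ (x ℤ.* + 1) ℤ.* y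
  identity = ℤ-Ring.solve-∀

d*[1/d]≡1 : ∀ d → ℕtoℚ (suc d) * ((+ 1) / suc d) ≡ 1ℚ
d*[1/d]≡1 d = ≡-via-ℚᵘ
  (toℚᵘ-* (ℕtoℚ (suc d)) _ (toℚᵘ-/ (+ suc d) 0) (toℚᵘ-/ (+ 1) d)) (toℚᵘ-/ (+ 1) 0)
  (ℚᵘ.*≡* (trans (identity (+ suc d)) (cong (λ e → + 1 ℤ.* + suc e) (sym (ℕ.+-identityʳ d)))))
  where
  identity : ∀ x → (x ℤ.* + 1) ℤ.* + 1 ≡ + 1 ℤ.* x
  identity = ℤ-Ring.solve-∀

1/[2+2p]≡½*1/[1+p] : ∀ p → (+ 1) / suc (suc (2 ℕ.* p)) ≡ ½ * ((+ 1) / suc p)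
1/[2+2p]≡½*1/[1+p] p = ≡-via-ℚᵘ (toℚᵘ-/ (+ 1) (suc (2 ℕ.* p)))
  (toℚᵘ-* ½ _ (toℚᵘ-/ (+ 1) 1) (toℚᵘ-/ (+ 1) p))
  (ℚᵘ.*≡* (trans (cong (λ e → + 1 ℤ.* + suc e) (denominator p)) (identity (+ suc (suc (2 ℕ.* p))))))
  where
  denominator : ∀ p → p ℕ.+ 1 ℕ.* suc p ≡ suc (2 ℕ.* p)
  denominator = ℕ-Ring.solve-∀
  identity : ∀ x → + 1 ℤ.* x ≡ (+ 1 ℤ.* + 1) ℤ.* x
  identity = ℤ-Ring.solve-∀

∑ : ℕ → (ℕ → ℚ) → ℚ
∑ zero    f = 0ℚ
∑ (suc n) f = ∑ n f + f n

sumℚ-∷ʳ : ∀ xs x → sumℚ (xs ∷ʳ x) ≡ sumℚ xs + x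
sumℚ-∷ʳ []       x = trans (+-identityʳ x) (sym (+-identityˡ x))
sumℚ-∷ʳ (y ∷ ys) x = trans (cong (λ s → y + s) (sumℚ-∷ʳ ys x)) (sym (+-assoc y (sumℚ ys) x))

sumℚ-applyUpTo : ∀ f n → sumℚ (applyUpTo f n) ≡ ∑ n f
sumℚ-applyUpTo f zero    = refl
sumℚ-applyUpTo f (suc n) = begin
  sumℚ (applyUpTo f (suc n))    ≡⟨ cong sumℚ (applyUpTo-∷ʳ f n) ⟨
  sumℚ (applyUpTo f n ∷ʳ f n)   ≡⟨ sumℚ-∷ʳ (applyUpTo f n) (f n) ⟩
  sumℚ (applyUpTo f n) + f n    ≡⟨ cong (_+ f n) (sumℚ-applyUpTo f n) ⟩
  ∑ n f + f n                   ∎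
  where open ≡-Reasoning

∑-cong : ∀ n {f g} → (∀ i → f i ≡ g i) → ∑ n f ≡ ∑ n g
∑-cong zero    f≡g = refl
∑-cong (suc n) f≡g = cong₂ _+_ (∑-cong n f≡g) (f≡g n)

∑-+ : ∀ n {f g h} → (∀ i → i ℕ.< n → f i ≡ g i + h i) → ∑ n f ≡ ∑ n g + ∑ n h
∑-+ zero    f≡g+h = sym (+-identityʳ 0ℚ)
∑-+ (suc n) {f} {g} {h} f≡g+h = begin
  ∑ n f + f n
    ≡⟨ cong₂ _+_ (∑-+ n (λ i i<n → f≡g+h i (ℕ.m<n⇒m<1+n i<n))) (f≡g+h n ℕ.≤-refl) ⟩
  (∑ n g + ∑ n h) + (g n + h n)
    ≡⟨ interchange (∑ n g) (∑ n h) (g n) (h n) ⟩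
  (∑ n g + g n) + (∑ n h + h n)
    ∎
  where
  open ≡-Reasoning
  interchange : ∀ a b c d → (a + b) + (c + d) ≡ (a + c) + (b + d)
  interchange = solve-∀ ℚ-ring

-- Recurrences along n ↦ 2n, 2n + 1

ρ : ℕ → ℚ
ρ i = ((+ 1) / suc i) * ℕtoℚ (α (suc i))

S : ℕ → ℚ
S n = ∑ n ρ

G-as-∑ : ∀ n → G n ≡ ∑ n (λ i → ℕtoℚ (n ℕ.∸ i) * ρ i)
G-as-∑ n = begin
  G n                                                    ≡⟨ cong sumℚ (map-upTo _ n) ⟩
  sumℚ (applyUpTo term n)                                ≡⟨ sumℚ-applyUpTo term n ⟩
  ∑ n term                                               ≡⟨ ∑-cong n split ⟩
  ∑ n (λ i → ℕtoℚ (n ℕ.∸ i) * ρ i)                       ∎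
  where
  open ≡-Reasoning
  term : ℕ → ℚ
  term i = ((+ (n ℕ.∸ i)) / suc i) * ℕtoℚ (α (suc i))
  split : ∀ i → term i ≡ ℕtoℚ (n ℕ.∸ i) * ρ i
  split i = trans (cong (_* ℕtoℚ (α (suc i))) (k/d≡k*[1/d] (n ℕ.∸ i) i))
                  (*-assoc (ℕtoℚ (n ℕ.∸ i)) ((+ 1) / suc i) (ℕtoℚ (α (suc i))))

G-suc : ∀ n → G (suc n) ≡ G n + S (suc n)
G-suc n = begin
  G (suc n)                                                 ≡⟨ G-as-∑ (suc n) ⟩
  ∑ n (λ i → ℕtoℚ (suc n ℕ.∸ i) * ρ i) + ℕtoℚ (suc n ℕ.∸ n) * ρ n
    ≡⟨ cong₂ _+_ (∑-+ n weight-suc) (cong (λ k → ℕtoℚ k * ρ n) (ℕ.m+n∸n≡m 1 n)) ⟩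
  (W + S n) + 1ℚ * ρ n                                      ≡⟨ regroup W (S n) (ρ n) ⟩
  W + S (suc n)                                             ≡⟨ cong (_+ S (suc n)) (G-as-∑ n) ⟨
  G n + S (suc n)                                           ∎
  where
  open ≡-Reasoning
  W = ∑ n (λ i → ℕtoℚ (n ℕ.∸ i) * ρ i)
  weight-suc : ∀ i → i ℕ.< n → ℕtoℚ (suc n ℕ.∸ i) * ρ i ≡ ℕtoℚ (n ℕ.∸ i) * ρ i + ρ i
  weight-suc i i<n = begin
    ℕtoℚ (suc n ℕ.∸ i) * ρ i       ≡⟨ cong (λ k → ℕtoℚ k * ρ i) (ℕ.+-∸-assoc 1 (ℕ.<⇒≤ i<n)) ⟩
    ℕtoℚ (suc (n ℕ.∸ i)) * ρ i     ≡⟨ cong (_* ρ i) (ℕtoℚ-suc (n ℕ.∸ i)) ⟩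
    (1ℚ + ℕtoℚ (n ℕ.∸ i)) * ρ i    ≡⟨ distrib (ℕtoℚ (n ℕ.∸ i)) (ρ i) ⟩
    ℕtoℚ (n ℕ.∸ i) * ρ i + ρ i     ∎
    where
    distrib : ∀ m w → (1ℚ + m) * w ≡ m * w + w
    distrib = solve-∀ ℚ-ring
  regroup : ∀ g s r → (g + s) + 1ℚ * r ≡ g + (s + r)
  regroup = solve-∀ ℚ-ring

double-suc : ∀ p → 2 ℕ.* suc p ≡ suc (suc (2 ℕ.* p))
double-suc p = cong suc (ℕ.+-suc p (p ℕ.+ 0))

ρ[2p]≡1 : ∀ p → ρ (2 ℕ.* p) ≡ 1ℚ
ρ[2p]≡1 p = begin
  1/k * ℕtoℚ (α k)     ≡⟨ cong (λ a → 1/k * ℕtoℚ a) (α-odd p) ⟩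
  1/k * ℕtoℚ k         ≡⟨ *-comm 1/k (ℕtoℚ k) ⟩
  ℕtoℚ k * 1/k         ≡⟨ d*[1/d]≡1 (2 ℕ.* p) ⟩
  1ℚ                   ∎
  where
  open ≡-Reasoning
  k = suc (2 ℕ.* p)
  1/k = (+ 1) / k

ρ[1+2p]≡½ρ[p] : ∀ p → ρ (suc (2 ℕ.* p)) ≡ ½ * ρ p
ρ[1+2p]≡½ρ[p] p = begin
  ((+ 1) / suc (suc (2 ℕ.* p))) * ℕtoℚ (α (suc (suc (2 ℕ.* p))))
    ≡⟨ cong₂ _*_ (1/[2+2p]≡½*1/[1+p] p) (cong (ℕtoℚ ∘ α) (sym (double-suc p))) ⟩
  (½ * ((+ 1) / suc p)) * ℕtoℚ (α (2 ℕ.* suc p))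
    ≡⟨ cong (λ a → (½ * ((+ 1) / suc p)) * ℕtoℚ a) (α-double (suc p)) ⟩
  (½ * ((+ 1) / suc p)) * ℕtoℚ (α (suc p))
    ≡⟨ *-assoc ½ ((+ 1) / suc p) (ℕtoℚ (α (suc p))) ⟩
  ½ * ρ p
    ∎
  where open ≡-Reasoning

S[2p]≡p+½S[p] : ∀ p → S (2 ℕ.* p) ≡ ℕtoℚ p + ½ * S p
S[2p]≡p+½S[p] zero    = refl
S[2p]≡p+½S[p] (suc p) = begin
  S (2 ℕ.* suc p)
    ≡⟨ cong S (double-suc p) ⟩
  S (2 ℕ.* p) + ρ (2 ℕ.* p) + ρ (suc (2 ℕ.* p))
    ≡⟨ cong₂ _+_ (cong₂ _+_ (S[2p]≡p+½S[p] p) (ρ[2p]≡1 p)) (ρ[1+2p]≡½ρ[p] p) ⟩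
  (ℕtoℚ p + ½ * S p + 1ℚ) + ½ * ρ p
    ≡⟨ regroup (ℕtoℚ p) (S p) (ρ p) ⟩
  (1ℚ + ℕtoℚ p) + ½ * (S p + ρ p)
    ≡⟨ cong (_+ ½ * S (suc p)) (ℕtoℚ-suc p) ⟨
  ℕtoℚ (suc p) + ½ * S (suc p)
    ∎
  where
  open ≡-Reasoning
  regroup : ∀ x s r → (x + ½ * s + 1ℚ) + ½ * r ≡ (1ℚ + x) + ½ * (s + r)
  regroup = solve-∀ ℚ-ring

S[1+2p]≡p+1+½S[p] : ∀ p → S (suc (2 ℕ.* p)) ≡ ℕtoℚ p + 1ℚ + ½ * S p
S[1+2p]≡p+1+½S[p] p =
  trans (cong₂ _+_ (S[2p]≡p+½S[p] p) (ρ[2p]≡1 p)) (regroup (ℕtoℚ p) (S p))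
  where
  regroup : ∀ x s → x + ½ * s + 1ℚ ≡ x + 1ℚ + ½ * s
  regroup = solve-∀ ℚ-ring

G[1+2p]≡[1+p]²+G[p] : ∀ p → G (suc (2 ℕ.* p)) ≡ ℕtoℚ (suc p) * ℕtoℚ (suc p) + G p
G[1+2p]≡[1+p]²+G[p] zero    = refl
G[1+2p]≡[1+p]²+G[p] (suc p) = begin
  G (suc (2 ℕ.* suc p))
    ≡⟨ cong (G ∘ suc) (double-suc p) ⟩
  G (3+2p)
    ≡⟨ G-suc (2+2p) ⟩
  G (2+2p) + S (3+2p)
    ≡⟨ cong (_+ S (3+2p)) (G-suc (1+2p)) ⟩
  G (1+2p) + S (2+2p) + S (3+2p)
    ≡⟨ cong₂ _+_ (cong₂ _+_ (G[1+2p]≡[1+p]²+G[p] p) (cong S (sym (double-suc p))))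
                 (cong (S ∘ suc) (sym (double-suc p))) ⟩
  (y * y + G p) + S (2 ℕ.* suc p) + S (suc (2 ℕ.* suc p))
    ≡⟨ cong₂ _+_ (cong (λ t → y * y + G p + t) (S[2p]≡p+½S[p] (suc p))) (S[1+2p]≡p+1+½S[p] (suc p)) ⟩
  (y * y + G p) + (y + ½ * s) + (y + 1ℚ + ½ * s)
    ≡⟨ complete-square y (G p) s ⟩
  (1ℚ + y) * (1ℚ + y) + (G p + s)
    ≡⟨ cong₂ (λ z g → z * z + g) (ℕtoℚ-suc (suc p)) (G-suc p) ⟨
  ℕtoℚ (suc (suc p)) * ℕtoℚ (suc (suc p)) + G (suc p)
    ∎
  where
  open ≡-Reasoning
  1+2p = suc (2 ℕ.* p)
  2+2p = suc 1+2p
  3+2p = suc 2+2p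
  y = ℕtoℚ (suc p)
  s = S (suc p)
  complete-square : ∀ y g s → (y * y + g) + (y + ½ * s) + (y + 1ℚ + ½ * s)
                            ≡ (1ℚ + y) * (1ℚ + y) + (g + s)
  complete-square = solve-∀ ℚ-ring

G[2p]≡p[1+p]+G[p]-½S[p] : ∀ p → G (2 ℕ.* p) ≡ ℕtoℚ p * ℕtoℚ (suc p) + G p - ½ * S p
G[2p]≡p[1+p]+G[p]-½S[p] p = begin
  G (2 ℕ.* p)                                    ≡⟨ add-sub (G (2 ℕ.* p)) (S 1+2p) ⟩
  G (2 ℕ.* p) + S 1+2p - S 1+2p                  ≡⟨ cong (_- S 1+2p) (G-suc (2 ℕ.* p)) ⟨
  G 1+2p - S 1+2p                                ≡⟨ cong₂ _-_ (G[1+2p]≡[1+p]²+G[p] p) (S[1+2p]≡p+1+½S[p] p) ⟩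
  y * y + G p - (x + 1ℚ + ½ * S p)               ≡⟨ cong (λ z → z * z + G p - (x + 1ℚ + ½ * S p)) (ℕtoℚ-suc p) ⟩
  (1ℚ + x) * (1ℚ + x) + G p - (x + 1ℚ + ½ * S p) ≡⟨ simplify x (G p) (S p) ⟩
  x * (1ℚ + x) + G p - ½ * S p                   ≡⟨ cong (λ z → x * z + G p - ½ * S p) (ℕtoℚ-suc p) ⟨
  x * y + G p - ½ * S p                          ∎
  where
  open ≡-Reasoning
  1+2p = suc (2 ℕ.* p)
  x = ℕtoℚ p
  y = ℕtoℚ (suc p)
  add-sub : ∀ a b → a ≡ a + b - b
  add-sub = solve-∀ ℚ-ring
  simplify : ∀ x g s → (1ℚ + x) * (1ℚ + x) + g - (x + 1ℚ + ½ * s) ≡ x * (1ℚ + x) + g - ½ * s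
  simplify = solve-∀ ℚ-ring

⅓ : ℚ
⅓ = (+ 1) / 3

⅔ : ℚ
⅔ = (+ 2) / 3

mainTerm : ℕ → ℚ
mainTerm n = (+ (n ℕ.* (n ℕ.+ 2))) / 3

D : ℕ → ℚ
D n = mainTerm n - G n

E : ℕ → ℚ
E n = S n - ⅔ * ℕtoℚ n

mainTerm-poly : ∀ n → mainTerm n ≡ ℕtoℚ n * (ℕtoℚ n + ℕtoℚ 2) * ⅓
mainTerm-poly n = trans (k/d≡k*[1/d] (n ℕ.* (n ℕ.+ 2)) 2)
  (cong (_* ⅓) (trans (ℕtoℚ-* n (n ℕ.+ 2)) (cong (ℕtoℚ n *_) (ℕtoℚ-+ n 2))))

D[1+2p]≡D[p] : ∀ p → D (suc (2 ℕ.* p)) ≡ D p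
D[1+2p]≡D[p] p = begin
  D (suc (2 ℕ.* p))
    ≡⟨ cong₂ _-_ (mainTerm-poly (suc (2 ℕ.* p))) (G[1+2p]≡[1+p]²+G[p] p) ⟩
  z * (z + ℕtoℚ 2) * ⅓ - (y * y + G p)
    ≡⟨ cong₂ (λ a b → a * (a + ℕtoℚ 2) * ⅓ - (b * b + G p)) (ℕtoℚ-suc-double p) (ℕtoℚ-suc p) ⟩
  (1ℚ + (x + x)) * ((1ℚ + (x + x)) + ℕtoℚ 2) * ⅓ - ((1ℚ + x) * (1ℚ + x) + G p)
    ≡⟨ simplify x (G p) ⟩
  x * (x + ℕtoℚ 2) * ⅓ - G p
    ≡⟨ cong (_- G p) (mainTerm-poly p) ⟨
  D p
    ∎
  where
  open ≡-Reasoning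
  x = ℕtoℚ p
  y = ℕtoℚ (suc p)
  z = ℕtoℚ (suc (2 ℕ.* p))
  simplify : ∀ x g → (1ℚ + (x + x)) * ((1ℚ + (x + x)) + ℕtoℚ 2) * ⅓ - ((1ℚ + x) * (1ℚ + x) + g)
                   ≡ x * (x + ℕtoℚ 2) * ⅓ - g
  simplify = solve-∀ ℚ-ring

D[2p]≡D[p]+½E[p] : ∀ p → D (2 ℕ.* p) ≡ D p + ½ * E p
D[2p]≡D[p]+½E[p] p = begin
  D (2 ℕ.* p)
    ≡⟨ cong₂ _-_ (mainTerm-poly (2 ℕ.* p)) (G[2p]≡p[1+p]+G[p]-½S[p] p) ⟩
  z * (z + ℕtoℚ 2) * ⅓ - (x * y + G p - ½ * S p)
    ≡⟨ cong₂ (λ a b → a * (a + ℕtoℚ 2) * ⅓ - (x * b + G p - ½ * S p)) (ℕtoℚ-double p) (ℕtoℚ-suc p) ⟩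
  (x + x) * ((x + x) + ℕtoℚ 2) * ⅓ - (x * (1ℚ + x) + G p - ½ * S p)
    ≡⟨ simplify x (G p) (S p) ⟩
  x * (x + ℕtoℚ 2) * ⅓ - G p + ½ * E p
    ≡⟨ cong (λ m → m - G p + ½ * E p) (mainTerm-poly p) ⟨
  D p + ½ * E p
    ∎
  where
  open ≡-Reasoning
  x = ℕtoℚ p
  y = ℕtoℚ (suc p)
  z = ℕtoℚ (2 ℕ.* p)
  simplify : ∀ x g s → (x + x) * ((x + x) + ℕtoℚ 2) * ⅓ - (x * (1ℚ + x) + g - ½ * s)
                     ≡ x * (x + ℕtoℚ 2) * ⅓ - g + ½ * (s - ⅔ * x)
  simplify = solve-∀ ℚ-ring

E[2p]≡½E[p] : ∀ p → E (2 ℕ.* p) ≡ ½ * E p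
E[2p]≡½E[p] p =
  trans (cong₂ (λ s y → s - ⅔ * y) (S[2p]≡p+½S[p] p) (ℕtoℚ-double p)) (simplify (ℕtoℚ p) (S p))
  where
  simplify : ∀ x s → x + ½ * s - ⅔ * (x + x) ≡ ½ * (s - ⅔ * x)
  simplify = solve-∀ ℚ-ring

E[1+2p]≡½E[p]+⅓ : ∀ p → E (suc (2 ℕ.* p)) ≡ ½ * E p + ⅓
E[1+2p]≡½E[p]+⅓ p =
  trans (cong₂ (λ s y → s - ⅔ * y) (S[1+2p]≡p+1+½S[p] p) (ℕtoℚ-suc-double p)) (simplify (ℕtoℚ p) (S p))
  where
  simplify : ∀ x s → x + 1ℚ + ½ * s - ⅔ * (1ℚ + (x + x)) ≡ ½ * (s - ⅔ * x) + ⅓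
  simplify = solve-∀ ℚ-ring

-- The comparison sequence ϑ and the invariant

⅙ : ℚ
⅙ = (+ 1) / 6

ϑ : ℕ → ℚ
ϑ zero          = 0ℚ
ϑ (suc zero)    = ⅙
ϑ (suc (suc m)) = ½ * (ϑ (suc m) + ϑ m) + ⅙

½*-mono-≤ : ∀ {x y} → x ≤ y → ½ * x ≤ ½ * y
½*-mono-≤ = *-monoˡ-≤-nonNeg ½

ϑ-increments : ∀ m → ϑ m ≤ ϑ (suc m) × ϑ (suc m) ≤ ϑ m + ⅙
ϑ-increments zero    = toWitness {a? = 0ℚ ≤? ⅙} tt , toWitness {a? = ⅙ ≤? 0ℚ + ⅙} tt
ϑ-increments (suc m) with a≤b , b≤a+⅙ ← ϑ-increments m = b≤c , c≤b+⅙
  where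
  open ≤-Reasoning
  a = ϑ m
  b = ϑ (suc m)
  b≤c : b ≤ ½ * (b + a) + ⅙
  b≤c = begin
    b                           ≡⟨ halves b ⟩
    ½ * b + ½ * b               ≤⟨ +-monoʳ-≤ (½ * b) (½*-mono-≤ b≤a+⅙) ⟩
    ½ * b + ½ * (a + ⅙)         ≡⟨ regroup a b ⟩
    ½ * (b + a) + (+ 1) / 12    ≤⟨ +-monoʳ-≤ (½ * (b + a)) (toWitness {a? = (+ 1) / 12 ≤? ⅙} tt) ⟩
    ½ * (b + a) + ⅙             ∎
    where
    halves : ∀ b → b ≡ ½ * b + ½ * b
    halves = solve-∀ ℚ-ring
    regroup : ∀ a b → ½ * b + ½ * (a + ⅙) ≡ ½ * (b + a) + (+ 1) / 12
    regroup = solve-∀ ℚ-ring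
  c≤b+⅙ : ½ * (b + a) + ⅙ ≤ b + ⅙
  c≤b+⅙ = begin
    ½ * (b + a) + ⅙  ≤⟨ +-monoˡ-≤ ⅙ (½*-mono-≤ (+-monoʳ-≤ b a≤b)) ⟩
    ½ * (b + b) + ⅙  ≡⟨ cong (_+ ⅙) (halves b) ⟩
    b + ⅙            ∎
    where
    halves : ∀ b → ½ * (b + b) ≡ b
    halves = solve-∀ ℚ-ring

ϑ-mono : ∀ m → ϑ m ≤ ϑ (suc m)
ϑ-mono m = proj₁ (ϑ-increments m)

ϑ≤m/9+1/18 : ∀ m → ϑ m ≤ ((+ 1) / 9) * ℕtoℚ m + (+ 1) / 18
ϑ≤m/9+1/18 m = proj₁ (pair m)
  where
  bound : ℕ → ℚ
  bound m = ((+ 1) / 9) * ℕtoℚ m + (+ 1) / 18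
  bound-suc : ∀ m → bound (suc m) ≡ ((+ 1) / 9) * (1ℚ + ℕtoℚ m) + (+ 1) / 18
  bound-suc m = cong (λ y → ((+ 1) / 9) * y + (+ 1) / 18) (ℕtoℚ-suc m)
  pair : ∀ m → ϑ m ≤ bound m × ϑ (suc m) ≤ bound (suc m)
  pair zero = toWitness {a? = 0ℚ ≤? bound 0} tt , toWitness {a? = ⅙ ≤? bound 1} tt
  pair (suc m) with ϑ≤ , ϑ′≤ ← pair m = ϑ′≤ , (begin
    ½ * (ϑ (suc m) + ϑ m) + ⅙
      ≤⟨ +-monoˡ-≤ ⅙ (½*-mono-≤ (+-mono-≤ ϑ′≤ ϑ≤)) ⟩
    ½ * (bound (suc m) + bound m) + ⅙
      ≡⟨ cong (λ y → ½ * (y + bound m) + ⅙) (bound-suc m) ⟩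
    ½ * (((+ 1) / 9) * (1ℚ + x) + (+ 1) / 18 + (((+ 1) / 9) * x + (+ 1) / 18)) + ⅙
      ≡⟨ average x ⟩
    ((+ 1) / 9) * (1ℚ + (1ℚ + x)) + (+ 1) / 18
      ≡⟨ trans (bound-suc (suc m)) (cong (λ y → ((+ 1) / 9) * (1ℚ + y) + (+ 1) / 18) (ℕtoℚ-suc m)) ⟨
    bound (suc (suc m))
      ∎)
    where
    open ≤-Reasoning
    x = ℕtoℚ m
    average : ∀ x → ½ * (((+ 1) / 9) * (1ℚ + x) + (+ 1) / 18 + (((+ 1) / 9) * x + (+ 1) / 18)) + ⅙
                  ≡ ((+ 1) / 9) * (1ℚ + (1ℚ + x)) + (+ 1) / 18
    average = solve-∀ ℚ-ring

record DefectBounds (d e a b : ℚ) : Set where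
  field
    0≤e     : 0ℚ ≤ e
    0≤d     : 0ℚ ≤ d
    d≤a     : d ≤ a
    d+½e≤b  : d + ½ * e ≤ b
    d+e≤a+⅓ : d + e ≤ a + ⅓

DefectBounds-even : ∀ {d e a b} → DefectBounds d e a b → a ≤ b →
                    DefectBounds (d + ½ * e) (½ * e) b (½ * (b + a) + ⅙)
DefectBounds-even {d} {e} {a} {b} B a≤b = record
  { 0≤e     = ½*-mono-≤ 0≤e
  ; 0≤d     = +-mono-≤ 0≤d (½*-mono-≤ 0≤e)
  ; d≤a     = d+½e≤b
  ; d+½e≤b  = begin
      (d + ½ * e) + ½ * (½ * e)       ≡⟨ split d e ⟩
      ½ * (d + ½ * e) + ½ * (d + e)   ≤⟨ +-mono-≤ (½*-mono-≤ d+½e≤b) (½*-mono-≤ d+e≤a+⅓) ⟩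
      ½ * b + ½ * (a + ⅓)             ≡⟨ regroup a b ⟩
      ½ * (b + a) + ⅙                 ∎
  ; d+e≤a+⅓ = begin
      (d + ½ * e) + ½ * e             ≡⟨ halves d e ⟩
      d + e                           ≤⟨ d+e≤a+⅓ ⟩
      a + ⅓                           ≤⟨ +-monoˡ-≤ ⅓ a≤b ⟩
      b + ⅓                           ∎
  }
  where
  open DefectBounds B
  open ≤-Reasoning
  split : ∀ d e → (d + ½ * e) + ½ * (½ * e) ≡ ½ * (d + ½ * e) + ½ * (d + e)
  split = solve-∀ ℚ-ring
  regroup : ∀ a b → ½ * b + ½ * (a + ⅓) ≡ ½ * (b + a) + ⅙
  regroup = solve-∀ ℚ-ring
  halves : ∀ d e → (d + ½ * e) + ½ * e ≡ d + e
  halves = solve-∀ ℚ-ring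

DefectBounds-odd : ∀ {d e a b} → DefectBounds d e a b → a ≤ b →
                   DefectBounds d (½ * e + ⅓) b (½ * (b + a) + ⅙)
DefectBounds-odd {d} {e} {a} {b} B a≤b = record
  { 0≤e     = +-mono-≤ (½*-mono-≤ 0≤e) (toWitness {a? = 0ℚ ≤? ⅓} tt)
  ; 0≤d     = 0≤d
  ; d≤a     = ≤-trans d≤a a≤b
  ; d+½e≤b  = begin
      d + ½ * (½ * e + ⅓)             ≡⟨ split d e ⟩
      ½ * d + ½ * (d + ½ * e) + ⅙     ≤⟨ +-monoˡ-≤ ⅙ (+-mono-≤ (½*-mono-≤ d≤a) (½*-mono-≤ d+½e≤b)) ⟩
      ½ * a + ½ * b + ⅙               ≡⟨ regroup a b ⟩
      ½ * (b + a) + ⅙                 ∎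
  ; d+e≤a+⅓ = begin
      d + (½ * e + ⅓)                 ≡⟨ +-assoc d (½ * e) ⅓ ⟨
      (d + ½ * e) + ⅓                 ≤⟨ +-monoˡ-≤ ⅓ d+½e≤b ⟩
      b + ⅓                           ∎
  }
  where
  open DefectBounds B
  open ≤-Reasoning
  split : ∀ d e → d + ½ * (½ * e + ⅓) ≡ ½ * d + ½ * (d + ½ * e) + ⅙
  split = solve-∀ ℚ-ring
  regroup : ∀ a b → ½ * a + ½ * b + ⅙ ≡ ½ * (b + a) + ⅙
  regroup = solve-∀ ℚ-ring

data HalvingView : ℕ → Set where
  even : ∀ p → HalvingView (2 ℕ.* p)
  odd  : ∀ p → HalvingView (suc (2 ℕ.* p))

halvingView : ∀ n → HalvingView n
halvingView zero = even 0
halvingView (suc n) with halvingView n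
... | even p = odd p
... | odd p  = subst HalvingView (double-suc p) (even (suc p))

binary-induction : (P : ℕ → Set) → P 1 →
                   (∀ p → P (suc p) → P (2 ℕ.* suc p)) →
                   (∀ p → P (suc p) → P (suc (2 ℕ.* suc p))) →
                   ∀ n → 1 ℕ.≤ n → P n
binary-induction P P1 P-even P-odd =
  <-rec (λ n → 1 ℕ.≤ n → P n) (λ n rec → go n (halvingView n) rec)
  where
  go : ∀ n → HalvingView n → (∀ {m} → m ℕ.< n → 1 ℕ.≤ m → P m) → 1 ℕ.≤ n → P n
  go _ (even zero)    _   ()
  go _ (even (suc p)) rec _ = P-even p (rec (ℕ.m<m+n (suc p) (s≤s z≤n)) (s≤s z≤n))
  go _ (odd zero)     _   _ = P1
  go _ (odd (suc p))  rec _ = P-odd p (rec (s≤s (ℕ.m≤m+n (suc p) _)) (s≤s z≤n))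

⌊[1+2p]/2⌋≡p : ∀ p → ⌊ suc (2 ℕ.* p) /2⌋ ≡ p
⌊[1+2p]/2⌋≡p zero    = refl
⌊[1+2p]/2⌋≡p (suc p) = trans (cong (⌊_/2⌋ ∘ suc) (double-suc p)) (cong suc (⌊[1+2p]/2⌋≡p p))

⌊log₂[3+2p]⌋≡1+⌊log₂[1+p]⌋ : ∀ p → ⌊log₂ (suc (2 ℕ.* suc p)) ⌋ ≡ suc ⌊log₂ (suc p) ⌋
⌊log₂[3+2p]⌋≡1+⌊log₂[1+p]⌋ p = begin
  ⌊log₂ n ⌋                    ≡⟨ ℕ.m+[n∸m]≡n 1≤⌊log₂n⌋ ⟨
  suc (⌊log₂ n ⌋ ℕ.∸ 1)        ≡⟨ cong suc (⌊log₂⌊n/2⌋⌋≡⌊log₂n⌋∸1 n) ⟨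
  suc ⌊log₂ ⌊ n /2⌋ ⌋          ≡⟨ cong (λ m → suc ⌊log₂ m ⌋) (⌊[1+2p]/2⌋≡p (suc p)) ⟩
  suc ⌊log₂ (suc p) ⌋          ∎
  where
  open ≡-Reasoning
  n = suc (2 ℕ.* suc p)
  1≤⌊log₂n⌋ : 1 ℕ.≤ ⌊log₂ n ⌋
  1≤⌊log₂n⌋ = ⌊log₂⌋-mono-≤ {2} (s≤s (subst (1 ℕ.≤_) (sym (double-suc p)) (s≤s z≤n)))

defect-bounds : ∀ n → 1 ℕ.≤ n → DefectBounds (D n) (E n) (ϑ ⌊log₂ n ⌋) (ϑ (suc ⌊log₂ n ⌋))
defect-bounds = binary-induction (λ n → BoundsAt n ⌊log₂ n ⌋) base even-step odd-step
  where
  BoundsAt : ℕ → ℕ → Set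
  BoundsAt n m = DefectBounds (D n) (E n) (ϑ m) (ϑ (suc m))
  base : BoundsAt 1 0
  base = record
    { 0≤e     = toWitness {a? = _ ≤? _} tt
    ; 0≤d     = toWitness {a? = _ ≤? _} tt
    ; d≤a     = toWitness {a? = _ ≤? _} tt
    ; d+½e≤b  = toWitness {a? = _ ≤? _} tt
    ; d+e≤a+⅓ = toWitness {a? = _ ≤? _} tt
    }
  even-step : ∀ p → BoundsAt (suc p) ⌊log₂ suc p ⌋ →
              BoundsAt (2 ℕ.* suc p) ⌊log₂ (2 ℕ.* suc p) ⌋
  even-step p B = subst (BoundsAt (2 ℕ.* suc p)) (sym (⌊log₂[2*b]⌋≡1+⌊log₂b⌋ (suc p)))
    (subst₂ (λ d e → DefectBounds d e (ϑ (suc L)) (ϑ (suc (suc L))))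
      (sym (D[2p]≡D[p]+½E[p] (suc p))) (sym (E[2p]≡½E[p] (suc p)))
      (DefectBounds-even B (ϑ-mono L)))
    where L = ⌊log₂ suc p ⌋
  odd-step : ∀ p → BoundsAt (suc p) ⌊log₂ suc p ⌋ →
             BoundsAt (suc (2 ℕ.* suc p)) ⌊log₂ (suc (2 ℕ.* suc p)) ⌋
  odd-step p B = subst (BoundsAt (suc (2 ℕ.* suc p))) (sym (⌊log₂[3+2p]⌋≡1+⌊log₂[1+p]⌋ p))
    (subst₂ (λ d e → DefectBounds d e (ϑ (suc L)) (ϑ (suc (suc L))))
      (sym (D[1+2p]≡D[p] (suc p))) (sym (E[1+2p]≡½E[p]+⅓ (suc p)))
      (DefectBounds-odd B (ϑ-mono L)))
    where L = ⌊log₂ suc p ⌋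

-- ϑ ⌊log₂ n⌋ = θ n

jacobsthal : ℕ → ℕ
jacobsthal zero          = 0
jacobsthal (suc zero)    = 1
jacobsthal (suc (suc m)) = jacobsthal (suc m) ℕ.+ 2 ℕ.* jacobsthal m

ℕtoℚ-jacobsthal : ∀ m → ℕtoℚ (jacobsthal (suc (suc m)))
                      ≡ ℕtoℚ (jacobsthal (suc m)) + (ℕtoℚ (jacobsthal m) + ℕtoℚ (jacobsthal m))
ℕtoℚ-jacobsthal m = trans (ℕtoℚ-+ (jacobsthal (suc m)) (2 ℕ.* jacobsthal m))
                          (cong (λ y → ℕtoℚ (jacobsthal (suc m)) + y) (ℕtoℚ-double (jacobsthal m)))

alternatingSign : ℕ → ℚ
alternatingSign zero    = 1ℚ
alternatingSign (suc m) = - alternatingSign m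

alternatingSign≡±1 : ∀ m → alternatingSign m ≡ 1ℚ ⊎ alternatingSign m ≡ - 1ℚ
alternatingSign≡±1 zero = inj₁ refl
alternatingSign≡±1 (suc m) with alternatingSign≡±1 m
... | inj₁ σ≡1  = inj₂ (cong -_ σ≡1)
... | inj₂ σ≡-1 = inj₁ (cong -_ σ≡-1)

3*jacobsthal+sign≡2^ : ∀ m → ((+ 3) / 1) * ℕtoℚ (jacobsthal m) + alternatingSign m ≡ ℕtoℚ (2 ^ m)
3*jacobsthal+sign≡2^ m = proj₁ (pair m)
  where
  P : ℕ → Set
  P m = ((+ 3) / 1) * ℕtoℚ (jacobsthal m) + alternatingSign m ≡ ℕtoℚ (2 ^ m)
  pair : ∀ m → P m × P (suc m)
  pair zero = refl , refl
  pair (suc m) with Pm , Pm+1 ← pair m = Pm+1 , (begin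
    ((+ 3) / 1) * ℕtoℚ (jacobsthal (suc (suc m))) + - - σ
      ≡⟨ cong (λ y → ((+ 3) / 1) * y + - - σ) (ℕtoℚ-jacobsthal m) ⟩
    ((+ 3) / 1) * (j′ + (j + j)) + - - σ
      ≡⟨ regroup j j′ σ ⟩
    (((+ 3) / 1) * j′ + - σ) + ((((+ 3) / 1) * j + σ) + (((+ 3) / 1) * j + σ))
      ≡⟨ cong₂ _+_ Pm+1 (cong₂ _+_ Pm Pm) ⟩
    ℕtoℚ (2 ^ suc m) + (ℕtoℚ (2 ^ m) + ℕtoℚ (2 ^ m))
      ≡⟨ cong (λ y → ℕtoℚ (2 ^ suc m) + y) (ℕtoℚ-double (2 ^ m)) ⟨
    ℕtoℚ (2 ^ suc m) + ℕtoℚ (2 ^ suc m)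
      ≡⟨ ℕtoℚ-double (2 ^ suc m) ⟨
    ℕtoℚ (2 ^ suc (suc m))
      ∎)
    where
    open ≡-Reasoning
    j = ℕtoℚ (jacobsthal m)
    j′ = ℕtoℚ (jacobsthal (suc m))
    σ = alternatingSign m
    regroup : ∀ j j′ σ → ((+ 3) / 1) * (j′ + (j + j)) + - - σ
                       ≡ (((+ 3) / 1) * j′ + - σ) + ((((+ 3) / 1) * j + σ) + (((+ 3) / 1) * j + σ))
    regroup = solve-∀ ℚ-ring

floor-unique : ∀ (i : ℤ) (x : ℚ) → ℤtoℚ i ≤ x → x < ℤtoℚ (ℤ.suc i) → floor x ≡ i
floor-unique i x@(mkℚ num d-1 _) i≤x x<i+1 = ℤ.≤-antisym ⌊x⌋≤i i≤⌊x⌋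
  where
  d = + suc d-1
  ⌊x⌋ = num ℤ./ d
  i*d≤num : i ℤ.* d ℤ.≤ num
  i*d≤num with ℚᵘ.*≤* h ← ℚᵘ.≤-respˡ-≃ (toℚᵘ-/ i 0) (toℚᵘ-mono-≤ i≤x) =
    subst (i ℤ.* d ℤ.≤_) (ℤ.*-identityʳ num) h
  num<[i+1]*d : num ℤ.< ℤ.suc i ℤ.* d
  num<[i+1]*d with ℚᵘ.*<* h ← ℚᵘ.<-respʳ-≃ (toℚᵘ-/ (ℤ.suc i) 0) (toℚᵘ-mono-< x<i+1) =
    subst (ℤ._< ℤ.suc i ℤ.* d) (ℤ.*-identityʳ num) h
  num<[⌊x⌋+1]*d : num ℤ.< ℤ.suc ⌊x⌋ ℤ.* d
  num<[⌊x⌋+1]*d = subst (λ q → num ℤ.< ℤ.suc q ℤ.* d) (sym (ℤ.div-pos-is-/ℕ num (suc d-1)))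
                        (ℤ.n<s[n/ℕd]*d num (suc d-1))
  <-suc⇒≤ : ∀ {a b} → a ℤ.< ℤ.suc b → a ℤ.≤ b
  <-suc⇒≤ {a} {b} a<b+1 = subst (a ℤ.≤_) (ℤ.pred-suc b) (ℤ.i<j⇒i≤pred[j] a<b+1)
  i≤⌊x⌋ : i ℤ.≤ ⌊x⌋
  i≤⌊x⌋ = <-suc⇒≤ (ℤ.*-cancelʳ-<-nonNeg d (ℤ.≤-<-trans i*d≤num num<[⌊x⌋+1]*d))
  ⌊x⌋≤i : ⌊x⌋ ℤ.≤ i
  ⌊x⌋≤i = <-suc⇒≤ (ℤ.*-cancelʳ-<-nonNeg d (ℤ.≤-<-trans (ℤ.[n/d]*d≤n num d) num<[i+1]*d))

round-pos : ∀ p → 0ℚ < p → round p ≡ floor (p + ½)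
round-pos p 0<p = cong (λ b → if b then ceiling (p - ½) else floor (p + ½)) p≤ᵇ0≡false
  where
  p≤ᵇ0≡false : (p ≤ᵇ 0ℚ) ≡ false
  p≤ᵇ0≡false with p ≤ᵇ 0ℚ in p≤ᵇ0
  ... | false = refl
  ... | true  = contradiction (<-≤-trans 0<p (≤ᵇ⇒≤ (subst T (sym p≤ᵇ0) tt))) (<-irrefl refl)

round[2^m/3]≡jacobsthal : ∀ m → round ((+ (2 ^ m)) / 3) ≡ + jacobsthal m
round[2^m/3]≡jacobsthal m = trans (round-pos _ 0<2^m/3) (floor-unique (+ jacobsthal m) _ j≤x x<j+1)
  where
  open ≤-Reasoning
  instance
    2^m≢0 : ℕ.NonZero (2 ^ m)
    2^m≢0 = ℕ.m^n≢0 2 m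
  0<2^m/3 : 0ℚ < (+ (2 ^ m)) / 3
  0<2^m/3 = positive⁻¹ _ {{normalize-pos (2 ^ m) 3}}
  j = ℕtoℚ (jacobsthal m)
  σ = alternatingSign m
  frac = σ * ⅓ + ½
  x = (+ (2 ^ m)) / 3 + ½
  x≡j+frac : x ≡ j + frac
  x≡j+frac = begin-equality
    (+ (2 ^ m)) / 3 + ½             ≡⟨ cong (_+ ½) (k/d≡k*[1/d] (2 ^ m) 2) ⟩
    ℕtoℚ (2 ^ m) * ⅓ + ½            ≡⟨ cong (λ y → y * ⅓ + ½) (3*jacobsthal+sign≡2^ m) ⟨
    (((+ 3) / 1) * j + σ) * ⅓ + ½   ≡⟨ regroup j σ ⟩
    j + frac                        ∎
    where
    regroup : ∀ j σ → (((+ 3) / 1) * j + σ) * ⅓ + ½ ≡ j + (σ * ⅓ + ½)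
    regroup = solve-∀ ℚ-ring
  frac-bounds : 0ℚ ≤ frac × frac < 1ℚ
  frac-bounds with alternatingSign≡±1 m
  ... | inj₁ σ≡1  rewrite σ≡1  = toWitness {a? = _ ≤? _} tt , toWitness {a? = _ <? _} tt
  ... | inj₂ σ≡-1 rewrite σ≡-1 = toWitness {a? = _ ≤? _} tt , toWitness {a? = _ <? _} tt
  j≤x : j ≤ x
  j≤x = begin
    j              ≡⟨ +-identityʳ j ⟨
    j + 0ℚ         ≤⟨ +-monoʳ-≤ j (proj₁ frac-bounds) ⟩
    j + frac       ≡⟨ x≡j+frac ⟨
    x              ∎
  x<j+1 : x < ℕtoℚ (suc (jacobsthal m))
  x<j+1 = begin-strict
    x                          ≡⟨ x≡j+frac ⟩
    j + frac                   <⟨ +-monoʳ-< j (proj₂ frac-bounds) ⟩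
    j + 1ℚ                     ≡⟨ +-comm j 1ℚ ⟩
    1ℚ + j                     ≡⟨ ℕtoℚ-suc (jacobsthal m) ⟨
    ℕtoℚ (suc (jacobsthal m))  ∎

½^ : ℕ → ℚ
½^ zero    = 1ℚ
½^ (suc j) = ½ * ½^ j

½^-unique : ∀ (f : ℕ → ℚ) → f 0 ≡ 1ℚ → (∀ j → f (suc j) ≡ ½ * f j) → ∀ j → f j ≡ ½^ j
½^-unique f f0≡1 f-step zero    = f0≡1
½^-unique f f0≡1 f-step (suc j) = trans (f-step j) (cong (½ *_) (½^-unique f f0≡1 f-step j))

θ-formula : ℕ → ℤ → ℚ
θ-formula m r = ((+ 1) / 9) * (ℕtoℚ m + ℤtoℚ r * ½^ m)

-- θ computes its power of ½ by a local function; abstracting ⌊log₂ n⌋ lets unification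
-- pick that function as the f of ½^-unique.
θ-unfold : ∀ n → θ n ≡ θ-formula ⌊log₂ n ⌋ (round ((+ (2 ^ ⌊log₂ n ⌋)) / 3))
θ-unfold n with ⌊log₂ n ⌋ | ½^-unique _ refl (λ _ → refl)
... | m | local-½^≡½^ =
  cong (λ h → ((+ 1) / 9) * (ℕtoℚ m + ℤtoℚ (round ((+ (2 ^ m)) / 3)) * h)) (local-½^≡½^ m)

ϑ-closed-form : ∀ m → ϑ m ≡ θ-formula m (+ jacobsthal m)
ϑ-closed-form m = proj₁ (pair m)
  where
  closed : ℕ → ℚ
  closed m = θ-formula m (+ jacobsthal m)
  pair : ∀ m → ϑ m ≡ closed m × ϑ (suc m) ≡ closed (suc m)
  pair zero = refl , refl
  pair (suc m) with ϑm≡ , ϑm+1≡ ← pair m = ϑm+1≡ , (begin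
    ½ * (ϑ (suc m) + ϑ m) + ⅙
      ≡⟨ cong₂ (λ a b → ½ * (a + b) + ⅙) ϑm+1≡ ϑm≡ ⟩
    ½ * (closed (suc m) + closed m) + ⅙
      ≡⟨ cong (λ y → ½ * (((+ 1) / 9) * (y + j′ * (½ * h)) + closed m) + ⅙) (ℕtoℚ-suc m) ⟩
    ½ * (((+ 1) / 9) * ((1ℚ + x) + j′ * (½ * h)) + ((+ 1) / 9) * (x + j * h)) + ⅙
      ≡⟨ average x j j′ h ⟩
    ((+ 1) / 9) * ((1ℚ + (1ℚ + x)) + (j′ + (j + j)) * (½ * (½ * h)))
      ≡⟨ cong₂ (λ a b → ((+ 1) / 9) * (a + b * (½ * (½ * h))))
           (trans (ℕtoℚ-suc (suc m)) (cong (λ y → 1ℚ + y) (ℕtoℚ-suc m)))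
           (ℕtoℚ-jacobsthal m) ⟨
    closed (suc (suc m))
      ∎)
    where
    open ≡-Reasoning
    x = ℕtoℚ m
    j = ℕtoℚ (jacobsthal m)
    j′ = ℕtoℚ (jacobsthal (suc m))
    h = ½^ m
    average : ∀ x j j′ h →
              ½ * (((+ 1) / 9) * ((1ℚ + x) + j′ * (½ * h)) + ((+ 1) / 9) * (x + j * h)) + ⅙
              ≡ ((+ 1) / 9) * ((1ℚ + (1ℚ + x)) + (j′ + (j + j)) * (½ * (½ * h)))
    average = solve-∀ ℚ-ring

θ≡ϑ[⌊log₂⌋] : ∀ n → θ n ≡ ϑ ⌊log₂ n ⌋
θ≡ϑ[⌊log₂⌋] n = begin
  θ n                                           ≡⟨ θ-unfold n ⟩
  θ-formula m (round ((+ (2 ^ m)) / 3))         ≡⟨ cong (θ-formula m) (round[2^m/3]≡jacobsthal m) ⟩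
  θ-formula m (+ jacobsthal m)                  ≡⟨ ϑ-closed-form m ⟨
  ϑ m                                           ∎
  where
  open ≡-Reasoning
  m = ⌊log₂ n ⌋

corollary8 : (n : ℕ) → n ≥ 1 →
    (0ℚ ≤ ((+ (n Data.Nat.* (n Data.Nat.+ 2))) / 3) - G n)
    × ((((+ (n Data.Nat.* (n Data.Nat.+ 2))) / 3) - G n) ≤ θ n)
    × (θ n ≤ ((+ 1) / 9) * ℕtoℚ ⌊log₂ n ⌋ + (+ 1) / 18)
corollary8 n n≥1 =
  0≤d ,
  subst (D n ≤_) (sym (θ≡ϑ[⌊log₂⌋] n)) d≤a ,
  subst (_≤ ((+ 1) / 9) * ℕtoℚ ⌊log₂ n ⌋ + (+ 1) / 18) (sym (θ≡ϑ[⌊log₂⌋] n))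
        (ϑ≤m/9+1/18 ⌊log₂ n ⌋)
  where open DefectBounds (defect-bounds n n≥1)
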